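{- Consider an instance of Multistage Knapsack with $T$ time steps and its linear relaxation (LP-MK). Let $\hat S=(\hat x,\hat z)$ be a feasible solution of (LP-MK) with $\hat z_{ti}=1-|\hat x_{(t+1)i}-\hat x_{ti}|$ for all $t\in\{1,\dots,T-1\}$ and $i\in N$. If $\hat S$ is a basic solution of (LP-MK), then at most $T^3$ objects are fractional in $\hat S$, where an object $i$ is fractional if at least one of the variables $\hat x_{ti}$ ($1\le t\le T$) or $\hat z_{ti}$ ($1\le t\le T-1$) is not an integer.
   Context: Multistage Knapsack: given a time horizon $T\ge 1$, objects $N=\{1,\dots,n\}$, for each $t\in\{1,\dots,T\}$ and $i\in N$ a profit $p_{ti}$ and a weight $w_{ti}$, for each $t\in\{1,\dots,T-1\}$ and $i\in N$ a bonus $B_{ti}\ge 0$, and capacities $C_t$. (LP-MK) is the linear program with variables $x_{ti}\in[0,1]$ ($t=1,\dots,T$, $i\in N$) and $z_{ti}\in[0,1]$ ($t=1,\dots,T-1$, $i\in N$): maximize $\sum_{t=1}^T\sum_{i\in N}p_{ti}x_{ti}+\sum_{t=1}^{T-1}\sum_{i\in N}B_{ti}z_{ti}$ subject to $\sum_{i\in N}w_{ti}x_{ti}\le C_t$ for all $t$, $z_{ti}\le -x_{(t+1)i}+x_{ti}+1$ and $z_{ti}\le x_{(t+1)i}-x_{ti}+1$ for all $t\le T-1$, $i\in N$. A basic solution is a vertex (extreme point) of its feasible polyhedron, i.e. a feasible point that is not the midpoint of two distinct feasible points.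
   Formalization: The profits, weights, bonuses and capacities are rational, the solution $\hat S$ has rational coordinates, and the two feasible points in the definition of a basic solution are taken with rational coordinates. -}

module Defs where

open import Data.Nat as ℕ using (ℕ; suc)
open import Data.Fin using (Fin; inject₁) renaming (suc to fsuc)
open import Data.Fin.Base using () renaming (zero to fzero)
open import Data.Rational using (ℚ; 0ℚ; 1ℚ; ½; _+_; _-_; _*_; _≤_; ∣_∣)
open ℚ using (denominator-1)
open import Data.Product using (Σ; _×_; _,_; ∃)
open import Data.Sum using (_⊎_)
open import Data.List using (List; length; filter)


open import Data.List using (allFin) public
open import Relation.Binary.PropositionalEquality using (_≡_; _≢_)
open import Relation.Nullary using (¬_; Dec)
open import Relation.Nullary.Decidable using (¬?)
open import Data.Nat using (_≟_)
open import Data.Fin.Properties using (any?)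
open import Relation.Nullary.Decidable using (_⊎-dec_)

Σᶠ : (n : ℕ) → (Fin n → ℚ) → ℚ
Σᶠ ℕ.zero f = 0ℚ
Σᶠ (suc n) f = f fzero + Σᶠ n (λ i → f (fsuc i))

-- A Multistage Knapsack instance with T = suc m time steps (so T ≥ 1)
-- and n objects.  Time t ∈ {1..T} is Fin (suc m); transition t ∈ {1..T-1}
-- is Fin m, linking times (inject₁ t) and (fsuc t).
record Instance (m n : ℕ) : Set where
  field
    p : Fin (suc m) → Fin n → ℚ
    w : Fin (suc m) → Fin n → ℚ
    B : Fin m → Fin n → ℚ
    C : Fin (suc m) → ℚ
    B-nonneg : ∀ t i → 0ℚ ≤ B t i

record Point (m n : ℕ) : Set where
  constructor ⟨_,_⟩
  field
    x : Fin (suc m) → Fin n → ℚ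
    z : Fin m → Fin n → ℚ
open Point public

record Feasible {m n : ℕ} (I : Instance m n) (S : Point m n) : Set where
  open Instance I
  field
    x-lo : ∀ t i → 0ℚ ≤ x S t i
    x-hi : ∀ t i → x S t i ≤ 1ℚ
    z-lo : ∀ t i → 0ℚ ≤ z S t i
    z-hi : ∀ t i → z S t i ≤ 1ℚ
    capacity : ∀ t → Σᶠ n (λ i → w t i * x S t i) ≤ C t
    z-le₁ : ∀ t i → z S t i ≤ (x S (inject₁ t) i - x S (fsuc t) i) + 1ℚ
    z-le₂ : ∀ t i → z S t i ≤ (x S (fsuc t) i - x S (inject₁ t) i) + 1ℚ

Distinct : {m n : ℕ} → Point m n → Point m n → Set
Distinct S₁ S₂ =
  (∃ λ t → ∃ λ i → x S₁ t i ≢ x S₂ t i) ⊎ (∃ λ t → ∃ λ i → z S₁ t i ≢ z S₂ t i)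

Midpoint : {m n : ℕ} → Point m n → Point m n → Point m n → Set
Midpoint S S₁ S₂ =
  (∀ t i → x S t i ≡ ½ * (x S₁ t i + x S₂ t i)) ×
  (∀ t i → z S t i ≡ ½ * (z S₁ t i + z S₂ t i))

Basic : {m n : ℕ} → Instance m n → Point m n → Set
Basic I S = Feasible I S ×
  (∀ S₁ S₂ → Feasible I S₁ → Feasible I S₂ → Distinct S₁ S₂ → ¬ Midpoint S S₁ S₂)

-- A rational is an integer iff its (normalised) denominator is 1.
IsInteger : ℚ → Set
IsInteger q = denominator-1 q ≡ 0

isInteger? : (q : ℚ) → Dec (IsInteger q)
isInteger? q = denominator-1 q ≟ 0

Fractional : {m n : ℕ} → Point m n → Fin n → Set
Fractional {m} S i =
  (∃ λ (t : Fin (suc m)) → ¬ IsInteger (x S t i)) ⊎ (∃ λ (t : Fin m) → ¬ IsInteger (z S t i))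

fractional? : {m n : ℕ} → (S : Point m n) → (i : Fin n) → Dec (Fractional S i)
fractional? S i = any? (λ t → ¬? (isInteger? (x S t i))) ⊎-dec any? (λ t → ¬? (isInteger? (z S t i)))

numFractional : {m n : ℕ} → Point m n → ℕ
numFractional {n = n} S = length (filter (fractional? S) (allFin n))

-- For every fractional object j pick a value v_j in (0,1) taken by some x_{tj}, and move all the
-- coordinates x_{tj} equal to v_j together by the same amount d_j, resetting z to 1 - |x_{(t+1)j} - x_{tj}|.
-- The capacity sums are unchanged exactly when d solves T homogeneous linear equations, and for small d
-- the moved point stays in [0,1]. A small move changes the sign of no nonzero jump x_{(t+1)j} - x_{tj},
-- so z depends affinely on d and the given solution is the midpoint of the moves by d and -d. With more than
-- T fractional objects the linear system has a nonzero solution supported on them, contradicting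
-- basicness; so in fact at most T ≤ T³ objects are fractional.

module Submission where

open import Defs
open import Data.Nat as ℕ using (ℕ; zero; suc)
import Data.Nat.Properties as ℕₚ
open import Data.Fin as Fin using (Fin; inject₁; punchIn; punchOut) renaming (zero to fzero; suc to fsuc)
open import Data.Fin.Properties using (any?; all?; ¬∀⟶∃¬; punchIn-punchOut)
open import Data.Product using (∃-syntax; _×_; _,_; proj₁; proj₂)
open import Data.Sum using (_⊎_; inj₁; inj₂)
open import Function using (_∘_; id)
open import Data.Rational using (1ℚ; _-_; ∣_∣)
open import Relation.Binary.PropositionalEquality
open import Relation.Nullary using (¬_; Dec; yes; no; contradiction; _×-dec_)

module _ where
  open import Data.Rational
  open import Data.Rational.Properties
  open import Algebra.Properties.AbelianGroup +-0-abelianGroup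
    using (⁻¹-involutive; ⁻¹-anti-homo‿-; x∙y⁻¹≈ε⇒x≈y)
  open import Data.Rational.Solver
  open +-*-Solver

  ≤∧≢⇒< : ∀ {p q} → p ≤ q → p ≢ q → p < q
  ≤∧≢⇒< p≤q p≢q = ≰⇒> (λ q≤p → p≢q (≤-antisym p≤q q≤p))

  p≤q⇒0≤q-p : ∀ {p q} → p ≤ q → 0ℚ ≤ q - p
  p≤q⇒0≤q-p {p} {q} p≤q = subst (_≤ q - p) (+-inverseʳ p) (+-monoˡ-≤ (- p) p≤q)

  p<q⇒0<q-p : ∀ {p q} → p < q → 0ℚ < q - p
  p<q⇒0<q-p {p} {q} p<q = subst (_< q - p) (+-inverseʳ p) (+-monoˡ-< (- p) p<q)

  0≤q⇒p-q≤p : ∀ p {q} → 0ℚ ≤ q → p - q ≤ p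
  0≤q⇒p-q≤p p {q} 0≤q = subst (p - q ≤_) (+-identityʳ p) (+-monoʳ-≤ p (neg-antimono-≤ 0≤q))

  ∣p∣≡-p : ∀ {p} → p ≤ 0ℚ → ∣ p ∣ ≡ - p
  ∣p∣≡-p {p} p≤0 = trans (sym (∣-p∣≡∣p∣ p)) (0≤p⇒∣p∣≡p (neg-antimono-≤ p≤0))

  p≤∣p∣ : ∀ p → p ≤ ∣ p ∣
  p≤∣p∣ p with ≤-total 0ℚ p
  ... | inj₁ 0≤p = ≤-reflexive (sym (0≤p⇒∣p∣≡p 0≤p))
  ... | inj₂ p≤0 = ≤-trans p≤0 (0≤∣p∣ p)

  -∣p∣≤p : ∀ p → - ∣ p ∣ ≤ p
  -∣p∣≤p p with ≤-total 0ℚ p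
  ... | inj₁ 0≤p = ≤-trans (neg-antimono-≤ (0≤∣p∣ p)) 0≤p
  ... | inj₂ p≤0 = ≤-reflexive (trans (cong -_ (∣p∣≡-p p≤0)) (⁻¹-involutive p))

  ∣p∣≤q : ∀ {p q} → p ≤ q → - p ≤ q → ∣ p ∣ ≤ q
  ∣p∣≤q {p} p≤q -p≤q with ∣p∣≡p∨∣p∣≡-p p
  ... | inj₁ ∣p∣≡p = subst (_≤ _) (sym ∣p∣≡p) p≤q
  ... | inj₂ ∣p∣≡-p = subst (_≤ _) (sym ∣p∣≡-p) -p≤q

  ∣p-q∣≡∣q-p∣ : ∀ p q → ∣ p - q ∣ ≡ ∣ q - p ∣
  ∣p-q∣≡∣q-p∣ p q = trans (sym (∣-p∣≡∣p∣ (p - q))) (cong ∣_∣ (⁻¹-anti-homo‿- p q))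

  p≢q⇒0<∣p-q∣ : ∀ {p q} → p ≢ q → 0ℚ < ∣ p - q ∣
  p≢q⇒0<∣p-q∣ {p} {q} p≢q =
    ≤∧≢⇒< (0≤∣p∣ (p - q))
          (λ 0≡∣p-q∣ → p≢q (x∙y⁻¹≈ε⇒x≈y p q (∣p∣≡0⇒p≡0 (p - q) (sym 0≡∣p-q∣))))

  p+q≡p-q⇒q≡0 : ∀ {p q} → p + q ≡ p - q → q ≡ 0ℚ
  p+q≡p-q⇒q≡0 {p} {q} eq = begin
    q                         ≡⟨ solve 2 (λ p q → q := con ½ :* ((p :+ q) :- (p :- q))) refl p q ⟩
    ½ * ((p + q) - (p - q))   ≡⟨ cong (λ u → ½ * (u - (p - q))) eq ⟩
    ½ * ((p - q) - (p - q))   ≡⟨ solve 1 (λ u → con ½ :* (u :- u) := con 0ℚ) refl (p - q) ⟩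
    0ℚ                        ∎
    where open ≡-Reasoning

  p≡q⇒∣p-q∣≤∣r∣ : ∀ {p q} r → p ≡ q → ∣ p - q ∣ ≤ ∣ r ∣
  p≡q⇒∣p-q∣≤∣r∣ {q = q} r refl = subst (_≤ ∣ r ∣) (cong ∣_∣ (sym (+-inverseʳ q))) (0≤∣p∣ r)

  ∣q∣≤p⇒0≤p+q : ∀ {p q} → ∣ q ∣ ≤ p → 0ℚ ≤ p + q
  ∣q∣≤p⇒0≤p+q {p} {q} ∣q∣≤p = begin
    0ℚ            ≡⟨ sym (+-inverseʳ ∣ q ∣) ⟩
    ∣ q ∣ - ∣ q ∣ ≤⟨ +-monoʳ-≤ ∣ q ∣ (-∣p∣≤p q) ⟩
    ∣ q ∣ + q     ≤⟨ +-monoˡ-≤ q ∣q∣≤p ⟩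
    p + q         ∎
    where open ≤-Reasoning

  ∣q∣≤r-p⇒p+q≤r : ∀ {p q r} → ∣ q ∣ ≤ r - p → p + q ≤ r
  ∣q∣≤r-p⇒p+q≤r {p} {q} {r} ∣q∣≤r-p = begin
    p + q       ≤⟨ +-monoʳ-≤ p (≤-trans (p≤∣p∣ q) ∣q∣≤r-p) ⟩
    p + (r - p) ≡⟨ solve 2 (λ p r → p :+ (r :- p) := r) refl p r ⟩
    r           ∎
    where open ≤-Reasoning

  ∣p-q∣≤1 : ∀ {p q} → 0ℚ ≤ p → p ≤ 1ℚ → 0ℚ ≤ q → q ≤ 1ℚ → ∣ p - q ∣ ≤ 1ℚ
  ∣p-q∣≤1 {p} {q} 0≤p p≤1 0≤q q≤1 = ∣p∣≤q
    (≤-trans (0≤q⇒p-q≤p p 0≤q) p≤1)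
    (subst (_≤ 1ℚ) (sym (⁻¹-anti-homo‿- p q)) (≤-trans (0≤q⇒p-q≤p q 0≤p) q≤1))

  p-∣q∣≤p-q : ∀ p q → p - ∣ q ∣ ≤ p - q
  p-∣q∣≤p-q p q = +-monoʳ-≤ p (neg-antimono-≤ (p≤∣p∣ q))

  p-∣q∣≤p+q : ∀ p q → p - ∣ q ∣ ≤ p + q
  p-∣q∣≤p+q p q = +-monoʳ-≤ p (-∣p∣≤p q)

  ∣p+q∣+∣p-q∣≡p+p : ∀ {p q} → ∣ q ∣ ≤ p → ∣ p + q ∣ + ∣ p - q ∣ ≡ p + p
  ∣p+q∣+∣p-q∣≡p+p {p} {q} ∣q∣≤p = begin
    ∣ p + q ∣ + ∣ p - q ∣ ≡⟨ cong₂ _+_ (0≤p⇒∣p∣≡p (∣q∣≤p⇒0≤p+q ∣q∣≤p))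
                                      (0≤p⇒∣p∣≡p (∣q∣≤p⇒0≤p+q ∣-q∣≤p)) ⟩
    (p + q) + (p - q)     ≡⟨ solve 2 (λ p q → (p :+ q) :+ (p :- q) := p :+ p) refl p q ⟩
    p + p                 ∎
    where
    open ≡-Reasoning
    ∣-q∣≤p : ∣ - q ∣ ≤ p
    ∣-q∣≤p = subst (_≤ p) (sym (∣-p∣≡∣p∣ q)) ∣q∣≤p

  ∣p+q∣+∣p-q∣≡∣p∣+∣p∣ : ∀ {p q} → ∣ q ∣ ≤ ∣ p ∣ → ∣ p + q ∣ + ∣ p - q ∣ ≡ ∣ p ∣ + ∣ p ∣
  ∣p+q∣+∣p-q∣≡∣p∣+∣p∣ {p} {q} ∣q∣≤∣p∣ with ∣p∣≡p∨∣p∣≡-p p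
  ... | inj₁ ∣p∣≡p rewrite ∣p∣≡p = ∣p+q∣+∣p-q∣≡p+p ∣q∣≤∣p∣
  ... | inj₂ ∣p∣≡-p rewrite ∣p∣≡-p = begin
    ∣ p + q ∣ + ∣ p - q ∣         ≡⟨ cong₂ _+_ (∣-p∣≡∣p∣ (p + q)) (∣-p∣≡∣p∣ (p - q)) ⟨
    ∣ - (p + q) ∣ + ∣ - (p - q) ∣ ≡⟨ cong₂ (λ a b → ∣ a ∣ + ∣ b ∣)
                                      (solve 2 (λ p q → :- (p :+ q) := :- p :- q) refl p q)
                                      (solve 2 (λ p q → :- (p :- q) := :- p :+ q) refl p q) ⟩
    ∣ - p - q ∣ + ∣ - p + q ∣     ≡⟨ +-comm ∣ - p - q ∣ ∣ - p + q ∣ ⟩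
    ∣ - p + q ∣ + ∣ - p - q ∣     ≡⟨ ∣p+q∣+∣p-q∣≡p+p ∣q∣≤∣p∣ ⟩
    - p + - p                     ∎
    where open ≡-Reasoning

  p*q≢0 : ∀ {p q} → p ≢ 0ℚ → q ≢ 0ℚ → p * q ≢ 0ℚ
  p*q≢0 {p} {q} p≢0 q≢0 pq≡0 = q≢0 (begin
    q               ≡⟨ sym (*-identityˡ q) ⟩
    1ℚ * q          ≡⟨ cong (_* q) (sym (*-inverseˡ p)) ⟩
    1/ p * p * q    ≡⟨ *-assoc (1/ p) p q ⟩
    1/ p * (p * q)  ≡⟨ cong (1/ p *_) pq≡0 ⟩
    1/ p * 0ℚ       ≡⟨ *-zeroʳ (1/ p) ⟩
    0ℚ              ∎)
    where
    open ≡-Reasoning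
    instance
      p-nonZero : NonZero p
      p-nonZero = ≢-nonZero p≢0

  0<p⊓q : ∀ {p q} → 0ℚ < p → 0ℚ < q → 0ℚ < p ⊓ q
  0<p⊓q {p} {q} 0<p 0<q with ⊓-sel p q
  ... | inj₁ p⊓q≡p = subst (0ℚ <_) (sym p⊓q≡p) 0<p
  ... | inj₂ p⊓q≡q = subst (0ℚ <_) (sym p⊓q≡q) 0<q

  positiveLowerBound : ∀ n (f : Fin n → ℚ) → ∃[ ε ] 0ℚ < ε × (∀ j → 0ℚ < f j → ε ≤ f j)
  positiveLowerBound zero f = 1ℚ , positive⁻¹ 1ℚ , λ ()
  positiveLowerBound (suc n) f with positiveLowerBound n (f ∘ fsuc) | 0ℚ <? f fzero
  ... | ε , 0<ε , ε≤f | yes 0<f₀ = f fzero ⊓ ε , 0<p⊓q 0<f₀ 0<ε , λ where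
    fzero _ → p⊓q≤p (f fzero) ε
    (fsuc j) 0<fⱼ → p≤q⇒r⊓p≤q (f fzero) (ε≤f j 0<fⱼ)
  ... | ε , 0<ε , ε≤f | no 0≮f₀ = ε , 0<ε , λ where
    fzero 0<f₀ → contradiction 0<f₀ 0≮f₀
    (fsuc j) → ε≤f j

  upperBound : ∀ n (f : Fin n → ℚ) → ∃[ M ] 1ℚ ≤ M × (∀ j → f j ≤ M)
  upperBound zero f = 1ℚ , ≤-refl , λ ()
  upperBound (suc n) f with upperBound n (f ∘ fsuc)
  ... | M , 1≤M , f≤M = f fzero ⊔ M , p≤q⇒p≤r⊔q (f fzero) 1≤M , λ where
    fzero → p≤p⊔q (f fzero) M
    (fsuc j) → p≤q⇒p≤r⊔q (f fzero) (f≤M j)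

  scaleBelow : ∀ {n ε} (μ : Fin n → ℚ) → 0ℚ < ε →
               ∃[ c ] 0ℚ < c × (∀ s → ∣ s ∣ ≤ c → ∀ j → ∣ s * μ j ∣ ≤ ε)
  scaleBelow {n} {ε} μ 0<ε with upperBound n (∣_∣ ∘ μ)
  ... | M , 1≤M , ∣μ∣≤M = c , 0<c , ∣sμ∣≤ε
    where
    open ≤-Reasoning
    instance
      M-positive : Positive M
      M-positive = positive (<-≤-trans (positive⁻¹ 1ℚ) 1≤M)
      M-nonZero : NonZero M
      M-nonZero = pos⇒nonZero M
      ε-positive : Positive ε
      ε-positive = positive 0<ε
    c : ℚ
    c = ε * 1/ M
    0<c : 0ℚ < c
    0<c = positive⁻¹ c {{pos*pos⇒pos ε (1/ M) {{1/pos⇒pos M}}}}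
    ∣sμ∣≤ε : ∀ s → ∣ s ∣ ≤ c → ∀ j → ∣ s * μ j ∣ ≤ ε
    ∣sμ∣≤ε s ∣s∣≤c j = begin
      ∣ s * μ j ∣      ≡⟨ ∣p*q∣≡∣p∣*∣q∣ s (μ j) ⟩
      ∣ s ∣ * ∣ μ j ∣  ≤⟨ *-monoʳ-≤-nonNeg ∣ μ j ∣ {{∣-∣-nonNeg (μ j)}} ∣s∣≤c ⟩
      c * ∣ μ j ∣      ≤⟨ *-monoˡ-≤-nonNeg c {{nonNegative (<⇒≤ 0<c)}} (∣μ∣≤M j) ⟩
      c * M            ≡⟨ *-assoc ε (1/ M) M ⟩
      ε * (1/ M * M)   ≡⟨ cong (ε *_) (*-inverseˡ M) ⟩
      ε * 1ℚ           ≡⟨ *-identityʳ ε ⟩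
      ε                ∎

-- Linear dependence by Gaussian elimination
module _ where
  open import Data.Rational
  open import Data.Rational.Properties
  open import Algebra.Bundles using (CommutativeRing)
  open import Algebra.Properties.Semiring.Sum (CommutativeRing.semiring +-*-commutativeRing)
    using (sum; sum-cong-≗; sum-replicate-zero; ∑-distrib-+; *-distribʳ-sum)
  open import Data.Rational.Solver
  open +-*-Solver
  open import Data.Bool using (if_then_else_)
  open import Data.List using (length; filter; tabulate)
  open import Relation.Nullary using (does)
  open import Relation.Unary using (Decidable)

  count : ∀ {n} {A : Fin n → Set} → Decidable A → ℕ
  count {zero} A? = 0
  count {suc n} A? = if does (A? fzero) then suc (count (A? ∘ fsuc)) else count (A? ∘ fsuc)

  length-filter-tabulate : ∀ {X : Set} {P : X → Set} (P? : Decidable P) {n} (f : Fin n → X) →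
                           length (filter P? (tabulate f)) ≡ count (P? ∘ f)
  length-filter-tabulate P? {zero} f = refl
  length-filter-tabulate P? {suc n} f with P? (f fzero)
  ... | yes _ = cong suc (length-filter-tabulate P? (f ∘ fsuc))
  ... | no _ = length-filter-tabulate P? (f ∘ fsuc)

  record Dependency {n k} (A : Fin n → Set) (c : Fin n → Fin k → ℚ) : Set where
    field
      coeff : Fin n → ℚ
      coeff-supported : ∀ j → coeff j ≢ 0ℚ → A j
      witness : Fin n
      coeff-witness≢0 : coeff witness ≢ 0ℚ
      relation : ∀ r → sum (λ j → coeff j * c j r) ≡ 0ℚ

  Σᶠ≡sum : ∀ k (f : Fin k → ℚ) → Σᶠ k f ≡ sum f
  Σᶠ≡sum zero f = refl
  Σᶠ≡sum (suc k) f = cong (f fzero +_) (Σᶠ≡sum k (f ∘ fsuc))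

  sum-zero : ∀ {n} {f : Fin n → ℚ} → (∀ j → f j ≡ 0ℚ) → sum f ≡ 0ℚ
  sum-zero {n} f≡0 = trans (sum-cong-≗ f≡0) (sum-replicate-zero n)

  extendDependency : ∀ {n k} {A : Fin (suc n) → Set} {c : Fin (suc n) → Fin k → ℚ} →
                     Dependency (A ∘ fsuc) (c ∘ fsuc) → Dependency A c
  extendDependency {A = A} {c} D = record
    { coeff = coeff′
    ; coeff-supported = supported
    ; witness = fsuc witness
    ; coeff-witness≢0 = coeff-witness≢0
    ; relation = λ r → trans (cong₂ _+_ (*-zeroˡ (c fzero r)) (relation r)) (+-identityʳ 0ℚ)
    }
    where
    open Dependency D
    coeff′ : Fin _ → ℚ
    coeff′ fzero = 0ℚ
    coeff′ (fsuc j) = coeff j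
    supported : ∀ j → coeff′ j ≢ 0ℚ → A j
    supported fzero 0≢0 = contradiction refl 0≢0
    supported (fsuc j) = coeff-supported j

  unitDependency : ∀ {n k} {A : Fin (suc n) → Set} {c : Fin (suc n) → Fin k → ℚ} →
                   A fzero → (∀ r → c fzero r ≡ 0ℚ) → Dependency A c
  unitDependency {A = A} {c} A₀ c₀≡0 = record
    { coeff = coeff
    ; coeff-supported = supported
    ; witness = fzero
    ; coeff-witness≢0 = 1≢0
    ; relation = λ r → trans (cong₂ _+_ (trans (*-identityˡ (c fzero r)) (c₀≡0 r))
                                       (sum-zero (λ j → *-zeroˡ (c (fsuc j) r))))
                             (+-identityʳ 0ℚ)
    }
    where
    coeff : Fin _ → ℚ
    coeff fzero = 1ℚ
    coeff (fsuc j) = 0ℚ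
    supported : ∀ j → coeff j ≢ 0ℚ → A j
    supported fzero _ = A₀
    supported (fsuc j) 0≢0 = contradiction refl 0≢0

  module _ {n k} (c : Fin (suc n) → Fin (suc k) → ℚ) {t : Fin (suc k)} (c₀ₜ≢0 : c fzero t ≢ 0ℚ) where
    private
      instance
        c₀ₜ-nonZero : NonZero (c fzero t)
        c₀ₜ-nonZero = ≢-nonZero c₀ₜ≢0

    clearColumn : Fin n → Fin (suc k) → ℚ
    clearColumn l r = c (fsuc l) r - (c (fsuc l) t * 1/ c fzero t) * c fzero r

    clearColumn-pivot : ∀ l → clearColumn l t ≡ 0ℚ
    clearColumn-pivot l = begin
      a - (a * 1/ c₀ₜ) * c₀ₜ ≡⟨ cong (λ u → a - u) (*-assoc a (1/ c₀ₜ) c₀ₜ) ⟩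
      a - a * (1/ c₀ₜ * c₀ₜ) ≡⟨ cong (λ u → a - a * u) (*-inverseˡ c₀ₜ) ⟩
      a - a * 1ℚ             ≡⟨ solve 1 (λ a → a :- a :* con 1ℚ := con 0ℚ) refl a ⟩
      0ℚ                     ∎
      where
      open ≡-Reasoning
      a = c (fsuc l) t
      c₀ₜ = c fzero t

    pivotDependency : ∀ {A : Fin (suc n) → Set} → A fzero →
                      Dependency (A ∘ fsuc) (λ l r → clearColumn l (punchIn t r)) → Dependency A c
    pivotDependency {A} A₀ D = record
      { coeff = coeff′
      ; coeff-supported = supported
      ; witness = fsuc witness
      ; coeff-witness≢0 = coeff-witness≢0
      ; relation = relation′
      }
      where
      open Dependency D
      open ≡-Reasoning
      S : ℚ
      S = sum (λ l → coeff l * c (fsuc l) t)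
      coeff′ : Fin (suc n) → ℚ
      coeff′ fzero = - (S * 1/ c fzero t)
      coeff′ (fsuc l) = coeff l
      supported : ∀ j → coeff′ j ≢ 0ℚ → A j
      supported fzero _ = A₀
      supported (fsuc l) = coeff-supported l
      cleared : ∀ r → sum (λ j → coeff′ j * c j r) ≡ sum (λ l → coeff l * clearColumn l r)
      cleared r = sym (begin
        sum (λ l → coeff l * clearColumn l r)
          ≡⟨ sum-cong-≗ (λ l → solve 5 (λ μ a b p d → μ :* (a :- (b :* p) :* d)
                                                  := μ :* a :+ (μ :* b) :* (:- (p :* d)))
                                       refl (coeff l) (c (fsuc l) r) (c (fsuc l) t) (1/ c fzero t) (c fzero r)) ⟩
        sum (λ l → coeff l * c (fsuc l) r + coeff l * c (fsuc l) t * - (1/ c fzero t * c fzero r))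
          ≡⟨ ∑-distrib-+ (λ l → coeff l * c (fsuc l) r) _ ⟩
        X + sum (λ l → coeff l * c (fsuc l) t * - (1/ c fzero t * c fzero r))
          ≡⟨ cong (X +_) (sym (*-distribʳ-sum (- (1/ c fzero t * c fzero r)) (λ l → coeff l * c (fsuc l) t))) ⟩
        X + S * - (1/ c fzero t * c fzero r)
          ≡⟨ solve 4 (λ X S p d → X :+ S :* (:- (p :* d)) := :- (S :* p) :* d :+ X) refl X S (1/ c fzero t) (c fzero r) ⟩
        - (S * 1/ c fzero t) * c fzero r + X ∎)
        where
        X = sum (λ l → coeff l * c (fsuc l) r)
      relation′ : ∀ r → sum (λ j → coeff′ j * c j r) ≡ 0ℚ
      relation′ r with t Fin.≟ r
      ... | yes refl = trans (cleared t)
        (sum-zero (λ l → trans (cong (coeff l *_) (clearColumn-pivot l)) (*-zeroʳ (coeff l))))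
      ... | no t≢r = trans (cleared r) (subst (λ r → sum (λ l → coeff l * clearColumn l r) ≡ 0ℚ)
                                             (punchIn-punchOut t≢r) (relation (punchOut t≢r)))

  dependency : ∀ {n k} {A : Fin n → Set} (A? : Decidable A) (c : Fin n → Fin k → ℚ) →
               k ℕ.< count A? → Dependency A c
  dependencyFromHead : ∀ {n k} {A : Fin (suc n) → Set} (A? : Decidable A) (c : Fin (suc n) → Fin k → ℚ) →
                   A fzero → k ℕ.≤ count (A? ∘ fsuc) → Dependency A c

  dependency {zero} A? c ()
  dependency {suc n} A? c k<count with A? fzero
  ... | no _ = extendDependency (dependency (A? ∘ fsuc) (c ∘ fsuc) k<count)
  ... | yes A₀ = dependencyFromHead A? c A₀ (ℕ.s≤s⁻¹ k<count)

  dependencyFromHead {k = zero} A? c A₀ _ = unitDependency A₀ (λ ())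
  dependencyFromHead {k = suc k} A? c A₀ k<count with all? (λ r → c fzero r ≟ 0ℚ)
  ... | yes c₀≡0 = unitDependency A₀ c₀≡0
  ... | no c₀≢0 with ¬∀⟶∃¬ _ _ (λ r → c fzero r ≟ 0ℚ) c₀≢0
  ...   | t , c₀ₜ≢0 = pivotDependency c c₀ₜ≢0 A₀ (dependency (A? ∘ fsuc) _ k<count)

-- Points whose z is tight
module _ where
  open import Data.Rational
  open import Data.Rational.Properties
  open import Data.Rational.Solver
  open +-*-Solver

  tightZ : ∀ {m n} → (Fin (suc m) → Fin n → ℚ) → Fin m → Fin n → ℚ
  tightZ y t i = 1ℚ - ∣ y (fsuc t) i - y (inject₁ t) i ∣

  tight : ∀ {m n} → (Fin (suc m) → Fin n → ℚ) → Point m n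
  tight y = ⟨ y , tightZ y ⟩

  shift : ∀ {m n} → (Fin (suc m) → Fin n → ℚ) → ℚ → (Fin (suc m) → Fin n → ℚ) →
          Fin (suc m) → Fin n → ℚ
  shift y s δ t i = y t i + s * δ t i

  tight-feasible : ∀ {m n} (I : Instance m n) (y : Fin (suc m) → Fin n → ℚ) →
                   (∀ t i → 0ℚ ≤ y t i) → (∀ t i → y t i ≤ 1ℚ) →
                   (∀ t → Σᶠ n (λ i → Instance.w I t i * y t i) ≤ Instance.C I t) → Feasible I (tight y)
  tight-feasible I y 0≤y y≤1 capacity = record
    { x-lo = 0≤y
    ; x-hi = y≤1
    ; z-lo = λ t i → p≤q⇒0≤q-p (∣p-q∣≤1 (0≤y (fsuc t) i) (y≤1 (fsuc t) i)
                                        (0≤y (inject₁ t) i) (y≤1 (inject₁ t) i))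
    ; z-hi = λ t i → 0≤q⇒p-q≤p 1ℚ (0≤∣p∣ (Δ t i))
    ; capacity = capacity
    ; z-le₁ = λ t i → subst (tightZ y t i ≤_) (1-Δ≡-Δ+1 t i) (p-∣q∣≤p-q 1ℚ (Δ t i))
    ; z-le₂ = λ t i → subst (tightZ y t i ≤_) (+-comm 1ℚ (Δ t i)) (p-∣q∣≤p+q 1ℚ (Δ t i))
    }
    where
    Δ : Fin _ → Fin _ → ℚ
    Δ t i = y (fsuc t) i - y (inject₁ t) i
    1-Δ≡-Δ+1 : ∀ t i → 1ℚ - Δ t i ≡ (y (inject₁ t) i - y (fsuc t) i) + 1ℚ
    1-Δ≡-Δ+1 t i = solve 2 (λ a b → con 1ℚ :- (a :- b) := (b :- a) :+ con 1ℚ)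
                           refl (y (fsuc t) i) (y (inject₁ t) i)

  tight-midpoint : ∀ {m n} (S : Point m n) → (∀ t i → z S t i ≡ tightZ (x S) t i) →
                   ∀ s δ →
                   (∀ t i → ∣ s * δ (fsuc t) i - s * δ (inject₁ t) i ∣ ≤ ∣ x S (fsuc t) i - x S (inject₁ t) i ∣) →
                   Midpoint S (tight (shift (x S) s δ)) (tight (shift (x S) (- s) δ))
  tight-midpoint S S-tight s δ jump≤ = x-mid , λ t i → trans (S-tight t i) (z-mid t i)
    where
    open ≡-Reasoning
    x-mid : ∀ t i → x S t i ≡ ½ * (shift (x S) s δ t i + shift (x S) (- s) δ t i)
    x-mid t i = solve 3 (λ a s d → a := con ½ :* ((a :+ s :* d) :+ (a :+ (:- s) :* d))) refl (x S t i) s (δ t i)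
    z-mid : ∀ t i → tightZ (x S) t i ≡ ½ * (tightZ (shift (x S) s δ) t i + tightZ (shift (x S) (- s) δ) t i)
    z-mid t i = begin
      1ℚ - ∣ D ∣
        ≡⟨ solve 1 (λ a → con 1ℚ :- a := con ½ :* ((con 1ℚ :+ con 1ℚ) :- (a :+ a))) refl ∣ D ∣ ⟩
      ½ * ((1ℚ + 1ℚ) - (∣ D ∣ + ∣ D ∣))
        ≡⟨ cong (λ u → ½ * ((1ℚ + 1ℚ) - u)) (sym (∣p+q∣+∣p-q∣≡∣p∣+∣p∣ (jump≤ t i))) ⟩
      ½ * ((1ℚ + 1ℚ) - (∣ D + E ∣ + ∣ D - E ∣))
        ≡⟨ solve 2 (λ a b → con ½ :* ((con 1ℚ :+ con 1ℚ) :- (a :+ b))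
                          := con ½ :* ((con 1ℚ :- a) :+ (con 1ℚ :- b)))
                 refl ∣ D + E ∣ ∣ D - E ∣ ⟩
      ½ * ((1ℚ - ∣ D + E ∣) + (1ℚ - ∣ D - E ∣))
        ≡⟨ cong₂ (λ u v → ½ * ((1ℚ - ∣ u ∣) + (1ℚ - ∣ v ∣)))
             (solve 5 (λ a b s d e → (a :- b) :+ (s :* d :- s :* e) := (a :+ s :* d) :- (b :+ s :* e))
                    refl x₁ x₀ s δ₁ δ₀)
             (solve 5 (λ a b s d e → (a :- b) :- (s :* d :- s :* e) := (a :+ (:- s) :* d) :- (b :+ (:- s) :* e))
                    refl x₁ x₀ s δ₁ δ₀) ⟩
      ½ * (tightZ (shift (x S) s δ) t i + tightZ (shift (x S) (- s) δ) t i) ∎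
      where
      x₁ = x S (fsuc t) i
      x₀ = x S (inject₁ t) i
      δ₁ = δ (fsuc t) i
      δ₀ = δ (inject₁ t) i
      D = x₁ - x₀
      E = s * δ₁ - s * δ₀

  tight-distinct : ∀ {m n} (y : Fin (suc m) → Fin n → ℚ) s δ t i → s * δ t i ≢ 0ℚ →
                   Distinct (tight (shift y s δ)) (tight (shift y (- s) δ))
  tight-distinct y s δ t i sδ≢0 = inj₁ (t , i , λ eq →
    sδ≢0 (p+q≡p-q⇒q≡0 {y t i} (trans eq (cong (y t i +_) (sym (neg-distribˡ-* s (δ t i)))))))

  Interior : ℚ → Set
  Interior q = 0ℚ < q × q < 1ℚ

  interior? : ∀ q → Dec (Interior q)
  interior? q = (0ℚ <? q) ×-dec (q <? 1ℚ)

  ZeroOrOne : ℚ → Set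
  ZeroOrOne q = q ≡ 0ℚ ⊎ q ≡ 1ℚ

  zeroOrOne-unless-interior : ∀ {q} → 0ℚ ≤ q → q ≤ 1ℚ → ¬ Interior q → ZeroOrOne q
  zeroOrOne-unless-interior {q} 0≤q q≤1 ¬interior with q ≟ 0ℚ | q ≟ 1ℚ
  ... | yes q≡0 | _ = inj₁ q≡0
  ... | no _ | yes q≡1 = inj₂ q≡1
  ... | no q≢0 | no q≢1 = contradiction (≤∧≢⇒< 0≤q (q≢0 ∘ sym) , ≤∧≢⇒< q≤1 q≢1) ¬interior

  zeroOrOne-isInteger : ∀ {q} → ZeroOrOne q → IsInteger q
  zeroOrOne-isInteger (inj₁ refl) = refl
  zeroOrOne-isInteger (inj₂ refl) = refl

  tightZ-isInteger : ∀ {a b} → ZeroOrOne a → ZeroOrOne b → IsInteger (1ℚ - ∣ a - b ∣)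
  tightZ-isInteger (inj₁ refl) (inj₁ refl) = refl
  tightZ-isInteger (inj₁ refl) (inj₂ refl) = refl
  tightZ-isInteger (inj₂ refl) (inj₁ refl) = refl
  tightZ-isInteger (inj₂ refl) (inj₂ refl) = refl

  indicator : ∀ {A : Set} → Dec A → ℚ
  indicator (yes _) = 1ℚ
  indicator (no _) = 0ℚ

  indicator-yes : ∀ {A : Set} (A? : Dec A) → A → indicator A? ≡ 1ℚ
  indicator-yes (yes _) _ = refl
  indicator-yes (no ¬a) a = contradiction a ¬a

  indicator-no : ∀ {A : Set} (A? : Dec A) → ¬ A → indicator A? ≡ 0ℚ
  indicator-no (yes a) ¬a = contradiction a ¬a
  indicator-no (no _) _ = refl

-- Perturbing a tight basic solution
module _ {m n} {I : Instance m n} {S : Point m n} (S-feasible : Feasible I S)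
         (S-tight : ∀ t i → z S t i ≡ tightZ (x S) t i) where
  open import Data.Rational
  open import Data.Rational.Properties
  open import Algebra.Bundles using (CommutativeRing)
  open import Algebra.Properties.Semiring.Sum (CommutativeRing.semiring +-*-commutativeRing)
    using (sum; sum-cong-≗; ∑-distrib-+; *-distribˡ-sum)
  open import Data.Rational.Solver
  open +-*-Solver
  open import Relation.Nullary.Decidable using (toWitness; toSum)
  open import Data.Unit using (tt)
  open Instance I using (w; C)
  open Feasible S-feasible using (x-lo; x-hi; capacity)

  integral-if-zeroOrOne : ∀ j → (∀ t → ZeroOrOne (x S t j)) → ¬ Fractional S j
  integral-if-zeroOrOne j bits (inj₁ (t , ¬integer)) = ¬integer (zeroOrOne-isInteger (bits t))
  integral-if-zeroOrOne j bits (inj₂ (t , ¬integer)) =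
    ¬integer (subst IsInteger (sym (S-tight t j)) (tightZ-isInteger (bits (fsuc t)) (bits (inject₁ t))))

  opaque
    levelChoice : ∀ j → ∃[ v ] Interior v × (Fractional S j → ∃[ t ] x S t j ≡ v)
    levelChoice j with any? (λ t → interior? (x S t j))
    ... | yes (t , interior) = x S t j , interior , λ _ → t , refl
    -- An object without interior value gets the level ½, which it never attains.
    ... | no ¬interior = ½ , (toWitness {a? = 0ℚ <? ½} tt , toWitness {a? = ½ <? 1ℚ} tt) , λ fractional →
      contradiction fractional (integral-if-zeroOrOne j (λ t →
        zeroOrOne-unless-interior (x-lo t j) (x-hi t j) (λ interior → ¬interior (t , interior))))

  level : Fin n → ℚ
  level j = proj₁ (levelChoice j)

  level-interior : ∀ j → Interior (level j)
  level-interior j = proj₁ (proj₂ (levelChoice j))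

  level-attained : ∀ j → Fractional S j → ∃[ t ] x S t j ≡ level j
  level-attained j = proj₂ (proj₂ (levelChoice j))

  atLevel : Fin (suc m) → Fin n → ℚ
  atLevel t j = indicator (x S t j ≟ level j)

  column : Fin n → Fin (suc m) → ℚ
  column j t = w t j * atLevel t j

  margin : Fin n → ℚ
  margin j = level j ⊓ (1ℚ - level j)

  gapBound : ∀ j → ∃[ ε ] 0ℚ < ε × (∀ t → 0ℚ < ∣ x S t j - level j ∣ → ε ≤ ∣ x S t j - level j ∣)
  gapBound j = positiveLowerBound (suc m) (λ t → ∣ x S t j - level j ∣)

  slack : Fin n → ℚ
  slack j = margin j ⊓ proj₁ (gapBound j)

  slack-positive : ∀ j → 0ℚ < slack j
  slack-positive j = 0<p⊓q (0<p⊓q (proj₁ (level-interior j)) (p<q⇒0<q-p (proj₂ (level-interior j))))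
                           (proj₁ (proj₂ (gapBound j)))

  -- Moving a level by at most the radius keeps it in [0,1] and never lets it pass another value
  -- taken by the same object.
  radius : ℚ
  radius = proj₁ (positiveLowerBound n slack)

  0<radius : 0ℚ < radius
  0<radius = proj₁ (proj₂ (positiveLowerBound n slack))

  radius≤slack : ∀ j → radius ≤ slack j
  radius≤slack j = proj₂ (proj₂ (positiveLowerBound n slack)) j (slack-positive j)

  radius≤margin : ∀ j → radius ≤ margin j
  radius≤margin j = ≤-trans (radius≤slack j) (p⊓q≤p (margin j) (proj₁ (gapBound j)))

  radius≤gap : ∀ {t j} → x S t j ≢ level j → radius ≤ ∣ x S t j - level j ∣
  radius≤gap {t} {j} x≢v = ≤-trans (radius≤slack j)
    (≤-trans (p⊓q≤q (margin j) (proj₁ (gapBound j))) (proj₂ (proj₂ (gapBound j)) t (p≢q⇒0<∣p-q∣ x≢v)))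

  module _ (D : Dependency (Fractional S) column) where
    open Dependency D
    open ≤-Reasoning

    δ : Fin (suc m) → Fin n → ℚ
    δ t j = atLevel t j * coeff j

    displacement-on : ∀ s {t j} → x S t j ≡ level j → s * δ t j ≡ s * coeff j
    displacement-on s {t} {j} x≡v =
      trans (cong (λ a → s * (a * coeff j)) (indicator-yes (x S t j ≟ level j) x≡v))
            (cong (s *_) (*-identityˡ (coeff j)))

    displacement-off : ∀ s {t j} → x S t j ≢ level j → s * δ t j ≡ 0ℚ
    displacement-off s {t} {j} x≢v =
      trans (cong (λ a → s * (a * coeff j)) (indicator-no (x S t j ≟ level j) x≢v))
            (trans (cong (s *_) (*-zeroˡ (coeff j))) (*-zeroʳ s))

    capacity-preserved : ∀ s t → Σᶠ n (λ j → w t j * shift (x S) s δ t j) ≡ Σᶠ n (λ j → w t j * x S t j)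
    capacity-preserved s t = begin-equality
      Σᶠ n (λ j → w t j * shift (x S) s δ t j)
        ≡⟨ Σᶠ≡sum n _ ⟩
      sum (λ j → w t j * (x S t j + s * δ t j))
        ≡⟨ sum-cong-≗ (λ j → solve 5 (λ w x s a μ → w :* (x :+ s :* (a :* μ)) := w :* x :+ s :* (μ :* (w :* a)))
                                      refl (w t j) (x S t j) s (atLevel t j) (coeff j)) ⟩
      sum (λ j → w t j * x S t j + s * (coeff j * column j t))
        ≡⟨ ∑-distrib-+ (λ j → w t j * x S t j) _ ⟩
      Σwx + sum (λ j → s * (coeff j * column j t))
        ≡⟨ cong (Σwx +_) (sym (*-distribˡ-sum s (λ j → coeff j * column j t))) ⟩
      Σwx + s * sum (λ j → coeff j * column j t)
        ≡⟨ cong (λ u → Σwx + s * u) (relation t) ⟩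
      Σwx + s * 0ℚ
        ≡⟨ trans (cong (Σwx +_) (*-zeroʳ s)) (+-identityʳ Σwx) ⟩
      Σwx
        ≡⟨ Σᶠ≡sum n _ ⟨
      Σᶠ n (λ j → w t j * x S t j) ∎
      where Σwx = sum (λ j → w t j * x S t j)

    module _ (s : ℚ) (small : ∀ j → ∣ s * coeff j ∣ ≤ radius) where
      shifted-range : ∀ t j → 0ℚ ≤ shift (x S) s δ t j × shift (x S) s δ t j ≤ 1ℚ
      shifted-range t j with toSum (x S t j ≟ level j)
      ... | inj₁ x≡v = subst (0ℚ ≤_) moved (∣q∣≤p⇒0≤p+q (p≤q⊓r⇒p≤q (level j) (1ℚ - level j) within))
                     , subst (_≤ 1ℚ) moved (∣q∣≤r-p⇒p+q≤r {level j} (p≤q⊓r⇒p≤r (level j) (1ℚ - level j) within))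
        where
        within : ∣ s * coeff j ∣ ≤ margin j
        within = ≤-trans (small j) (radius≤margin j)
        moved : level j + s * coeff j ≡ shift (x S) s δ t j
        moved = sym (cong₂ _+_ x≡v (displacement-on s x≡v))
      ... | inj₂ x≢v = subst (0ℚ ≤_) unmoved (x-lo t j) , subst (_≤ 1ℚ) unmoved (x-hi t j)
        where
        unmoved : x S t j ≡ shift (x S) s δ t j
        unmoved = sym (trans (cong (x S t j +_) (displacement-off s x≢v)) (+-identityʳ (x S t j)))

      shifted-feasible : Feasible I (tight (shift (x S) s δ))
      shifted-feasible = tight-feasible I (shift (x S) s δ)
        (λ t j → proj₁ (shifted-range t j)) (λ t j → proj₂ (shifted-range t j))
        (λ t → subst (_≤ C t) (sym (capacity-preserved s t)) (capacity t))

      shifted-jump : ∀ t j →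
                     ∣ s * δ (fsuc t) j - s * δ (inject₁ t) j ∣ ≤ ∣ x S (fsuc t) j - x S (inject₁ t) j ∣
      shifted-jump t j with toSum (x S (fsuc t) j ≟ level j) | toSum (x S (inject₁ t) j ≟ level j)
      ... | inj₁ x₁≡v | inj₁ x₀≡v =
        p≡q⇒∣p-q∣≤∣r∣ _ (trans (displacement-on s x₁≡v) (sym (displacement-on s x₀≡v)))
      ... | inj₂ x₁≢v | inj₂ x₀≢v =
        p≡q⇒∣p-q∣≤∣r∣ _ (trans (displacement-off s x₁≢v) (sym (displacement-off s x₀≢v)))
      ... | inj₁ x₁≡v | inj₂ x₀≢v = begin
        ∣ s * δ (fsuc t) j - s * δ (inject₁ t) j ∣
          ≡⟨ cong₂ (λ a b → ∣ a - b ∣) (displacement-on s x₁≡v) (displacement-off s x₀≢v) ⟩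
        ∣ s * coeff j - 0ℚ ∣              ≡⟨ cong ∣_∣ (+-identityʳ (s * coeff j)) ⟩
        ∣ s * coeff j ∣                   ≤⟨ small j ⟩
        radius                            ≤⟨ radius≤gap x₀≢v ⟩
        ∣ x S (inject₁ t) j - level j ∣   ≡⟨ cong (λ v → ∣ x S (inject₁ t) j - v ∣) x₁≡v ⟨
        ∣ x S (inject₁ t) j - x S (fsuc t) j ∣ ≡⟨ ∣p-q∣≡∣q-p∣ (x S (inject₁ t) j) (x S (fsuc t) j) ⟩
        ∣ x S (fsuc t) j - x S (inject₁ t) j ∣ ∎
      ... | inj₂ x₁≢v | inj₁ x₀≡v = begin
        ∣ s * δ (fsuc t) j - s * δ (inject₁ t) j ∣
          ≡⟨ cong₂ (λ a b → ∣ a - b ∣) (displacement-off s x₁≢v) (displacement-on s x₀≡v) ⟩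
        ∣ 0ℚ - s * coeff j ∣              ≡⟨ cong ∣_∣ (+-identityˡ (- (s * coeff j))) ⟩
        ∣ - (s * coeff j) ∣               ≡⟨ ∣-p∣≡∣p∣ (s * coeff j) ⟩
        ∣ s * coeff j ∣                   ≤⟨ small j ⟩
        radius                            ≤⟨ radius≤gap x₁≢v ⟩
        ∣ x S (fsuc t) j - level j ∣      ≡⟨ cong (λ v → ∣ x S (fsuc t) j - v ∣) x₀≡v ⟨
        ∣ x S (fsuc t) j - x S (inject₁ t) j ∣ ∎

    not-basic : ¬ Basic I S
    not-basic (_ , not-midpoint)
      with scaleBelow coeff 0<radius | level-attained witness (coeff-supported witness coeff-witness≢0)
    ... | c , 0<c , scaled | t₀ , x≡v =
      not-midpoint _ _ (shifted-feasible c (scaled c ∣c∣≤c)) (shifted-feasible (- c) (scaled (- c) ∣-c∣≤c))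
        (tight-distinct (x S) c δ t₀ witness
          (subst (_≢ 0ℚ) (sym (displacement-on c x≡v)) (p*q≢0 (≢-sym (<⇒≢ 0<c)) coeff-witness≢0)))
        (tight-midpoint S S-tight c δ (shifted-jump c (scaled c ∣c∣≤c)))
      where
      ∣c∣≤c : ∣ c ∣ ≤ c
      ∣c∣≤c = ≤-reflexive (0≤p⇒∣p∣≡p (<⇒≤ 0<c))
      ∣-c∣≤c : ∣ - c ∣ ≤ c
      ∣-c∣≤c = subst (_≤ c) (sym (∣-p∣≡∣p∣ c)) ∣c∣≤c

  fractional≤horizon : Basic I S → numFractional S ℕ.≤ suc m
  fractional≤horizon basic = ℕₚ.≮⇒≥ λ horizon<count →
    not-basic (dependency (fractional? S) column
                (subst (suc m ℕ.<_) (length-filter-tabulate (fractional? S) id) horizon<count))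
              basic

open import Data.Nat using (_≤_; _^_)

theorem3 : (m n : ℕ) (I : Instance m n) (S : Point m n)
    → Feasible I S
    → (∀ t i → z S t i ≡ 1ℚ - ∣ x S (fsuc t) i - x S (inject₁ t) i ∣)
    → Basic I S
    → numFractional S ≤ suc m ^ 3
theorem3 m n I S F hz B = ℕₚ.≤-trans (fractional≤horizon F hz B) (ℕₚ.m≤m*n (suc m) (suc m ^ 2))
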